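{- For all $r \in \mathbb{C}$, \[ e^{y\frac{d}{dx}}\big(\ell_{1}(x)^{r}\big)=\sum_{j \geq 0}\binom{r}{j}\ell_{1}(x)^{r-j}\sum_{m \geq j}(-1)^{m-j}\sum_{\substack{m_{1}+\cdots+m_{j}=m\\ m_i\ge1}}\frac{1}{m_{1}\cdots m_{j}}\left(\frac{y}{\ell_{0}(x)}\right)^{m}, \] where for $j=0$ the innermost sum is $1$ if $m=0$ and $0$ otherwise.
   Context: Let $\ell_{n}(x)$, $n \in \mathbb{Z}$, be commuting formal variables and let $\mathbb{C}\{[\ell]\}$ be the commutative algebra with basis all monomials $\prod_{i}\ell_{i}(x)^{r_{i}}$, $r_i\in\mathbb{C}$, almost all zero, multiplication adding exponents. Let $\frac{d}{dx}$ be the unique derivation with $\frac{d}{dx}\ell_{0}(x)^{r}=r\ell_{0}(x)^{r-1}$ and, for $n>0$, $\frac{d}{dx}\ell_{n}(x)^{r}=r\ell_{n}(x)^{r-1}\prod_{i=0}^{n-1}\ell_{i}(x)^{ -1}$, $\frac{d}{dx}\ell_{ -n}(x)^{r}=r\ell_{ -n}(x)^{r-1}\prod_{i=1}^{n}\ell_{ -i}(x)$. $y$ is a formal variable and $e^{y\frac{d}{dx}}=\sum_{k\ge0}\frac{y^k}{k!}(\frac{d}{dx})^k$. $\binom{r}{j}=r(r-1)\cdots(r-j+1)/j!$. -}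

module Defs where

open import Level using (Level; _⊔_)
open import Algebra.Bundles using (CommutativeRing)
open import Data.Nat using (ℕ; zero; suc; _∸_; _≤?_)
  renaming (_+_ to _+ℕ_)
open import Data.Integer using (ℤ; +_; -[1+_])
open import Data.List using (List; []; _∷_; _++_; map; upTo; concatMap; foldr)
open import Data.Product using (_×_; _,_)
open import Relation.Binary.PropositionalEquality using (_≡_)
open import Relation.Nullary using (yes; no)
import Data.Integer.Properties as ℤP
open import Function using (_∘_)

-- The coefficient field ℂ is replaced by an arbitrary commutative ℚ-algebra:
-- a commutative ring in which every positive natural number is invertible.
-- (ℂ is an instance.)
-- image of a natural number in a commutative ring
ringFromℕ : ∀ {c ℓ} (R : CommutativeRing c ℓ) → ℕ → CommutativeRing.Carrier R
ringFromℕ R zero    = CommutativeRing.0# R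
ringFromℕ R (suc n) = CommutativeRing._+_ R (CommutativeRing.1# R) (ringFromℕ R n)

record QAlgebra (c ℓ : Level) : Set (Level.suc (c ⊔ ℓ)) where
  field
    cring : CommutativeRing c ℓ
  open CommutativeRing cring public
  field
    inv      : ℕ → Carrier           -- inv n = 1 / (n + 1)
    inv-spec : ∀ n → ringFromℕ cring (suc n) * inv n ≈ 1#

  fromℕ : ℕ → Carrier
  fromℕ = ringFromℕ cring

module Construction {c ℓ : Level} (A : QAlgebra c ℓ) where
  open QAlgebra A public

  -- Monomials  ∏ ℓ_i(x)^{r_i}  as finite lists of (index i , exponent r_i);
  -- the monomial is the product of the listed factors (repetitions add).
  Mono : Set c
  Mono = List (ℤ × Carrier)

  expo : Mono → ℤ → Carrier
  expo []            i = 0#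
  expo ((j , r) ∷ m) i with j ℤP.≟ i
  ... | yes _ = r + expo m i
  ... | no  _ = expo m i

  _≋_ : Mono → Mono → Set ℓ
  m ≋ m' = ∀ i → expo m i ≈ expo m' i

  _·m_ : Mono → Mono → Mono
  _·m_ = _++_

  -- Elements of ℂ{[ℓ]}: finite formal linear combinations of monomials
  Poly : Set c
  Poly = List (Carrier × Mono)

  -- equality in the algebra: the congruence generated by reordering terms,
  -- combining like terms, dropping zero terms, and equality of coefficients
  -- and monomials.  (This is the free module with basis the monomials.)
  infix 4 _∼_
  data _∼_ : Poly → Poly → Set (c ⊔ ℓ) where
    ∼-refl  : ∀ {p} → p ∼ p
    ∼-sym   : ∀ {p q} → p ∼ q → q ∼ p
    ∼-trans : ∀ {p q s} → p ∼ q → q ∼ s → p ∼ s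
    ∼-cons  : ∀ {a a' m m' p p'} → a ≈ a' → m ≋ m' → p ∼ p' →
              ((a , m) ∷ p) ∼ ((a' , m') ∷ p')
    ∼-swap  : ∀ {t u p} → (t ∷ u ∷ p) ∼ (u ∷ t ∷ p)
    ∼-merge : ∀ {a b m p} → ((a , m) ∷ (b , m) ∷ p) ∼ ((a + b , m) ∷ p)
    ∼-zero  : ∀ {m p} → ((0# , m) ∷ p) ∼ p

  scale : Carrier → Poly → Poly
  scale a = map (λ { (b , m) → (a * b , m) })

  mulMono : Mono → Poly → Poly
  mulMono n = map (λ { (b , m) → (b , n ·m m) })

  -- The derivation d/dx
  -- dℓ_i : the monomial factor in d/dx ℓ_i^r = r ℓ_i^{r-1} · dℓ_i
  --   i = 0   : 1
  --   i = n>0 : ∏_{k=0}^{n-1} ℓ_k^{-1}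
  --   i = -n  : ∏_{k=1}^{n}   ℓ_{-k}
  dfac : ℤ → Mono
  dfac (+ n)      = map (λ k → (+ k , - 1#)) (upTo n)
  dfac -[1+ n ]   = map (λ k → (-[1+ k ] , 1#)) (upTo (suc n))

  dMono : Mono → Poly
  dMono []            = []
  dMono ((i , r) ∷ m) = (r , ((i , r - 1#) ∷ dfac i) ·m m)
                        ∷ mulMono ((i , r) ∷ []) (dMono m)

  D : Poly → Poly
  D []            = []
  D ((a , m) ∷ p) = scale a (dMono m) ++ D p

  Dⁿ : ℕ → Poly → Poly
  Dⁿ zero    p = p
  Dⁿ (suc k) p = D (Dⁿ k p)

  prod : List Carrier → Carrier
  prod = foldr _*_ 1#

  sumC : List Carrier → Carrier
  sumC = foldr _+_ 0#

  invFact : ℕ → Carrier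
  invFact k = prod (map inv (upTo k))

  binom : Carrier → ℕ → Carrier
  binom r j = prod (map (λ i → r - fromℕ i) (upTo j)) * invFact j

  sign : ℕ → Carrier
  sign zero    = 1#
  sign (suc n) = - sign n

  -- compositions of m into j positive parts, each part p stored as p ∸ 1
  comps : ℕ → ℕ → List (List ℕ)
  comps zero    zero    = [] ∷ []
  comps (suc m) zero    = []
  comps m       (suc j) =
    concatMap (λ q → map (q ∷_) (comps' q)) (upTo m)
    where
      -- first part is q+1 ≤ m, the rest is a composition of m - (q+1)
      comps' : ℕ → List (List ℕ)
      comps' q = comps (m ∸ suc q) j

  compSum : ℕ → ℕ → Carrier
  compSum m j = sumC (map (prod ∘ map inv) (comps m j))

  -- formal power series in y with coefficients in the algebra,
  -- given by their coefficient sequences; equality is coefficientwise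
  PowerSeries : Set c
  PowerSeries = ℕ → Poly

  _≈PS_ : PowerSeries → PowerSeries → Set (c ⊔ ℓ)
  f ≈PS g = ∀ k → f k ∼ g k

  -- e^{y d/dx} p = Σ_k y^k/k! (d/dx)^k p
  expYD : Poly → PowerSeries
  expYD p k = scale (invFact k) (Dⁿ k p)

  ℓ₁^ : Carrier → Poly
  ℓ₁^ r = (1# , (+ 1 , r) ∷ []) ∷ []

  -- The right-hand side
  --   Σ_{j≥0} binom(r,j) ℓ₁^{r-j} Σ_{m≥j} (-1)^{m-j} compSum(m,j) y^m ℓ₀^{-m}
  -- as a power series in y: its y^k coefficient collects the terms with
  -- m = k (and hence j ≤ k).
  rhsSeries : Carrier → PowerSeries
  rhsSeries r k =
    map (λ j → ( binom r j * (sign (k ∸ j) * compSum k j)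
               , (+ 1 , r - fromℕ j) ∷ (+ 0 , - fromℕ k) ∷ [] ))
        (upTo (suc k))

-- (d/dx)^k ℓ₁^r is a combination of the monomials ℓ₁^{r-j} ℓ₀^{-k}, j ≤ k, because
-- d/dx (ℓ₁^a ℓ₀^b) = a ℓ₁^{a-1} ℓ₀^{b-1} + b ℓ₁^a ℓ₀^{b-1}.  Its coefficients factor as
-- r(r-1)⋯(r-j+1) · s(k,j) with the signed Stirling numbers of the first kind,
-- s(k+1,j+1) = s(k,j) - k s(k,j+1).  The composition sums C(k,j) = Σ 1/(m₁⋯m_j) satisfy
-- k C(k,j+1) = (j+1) Σ_{i<k} C(i,j), which yields the same recurrence for
-- (-1)^{k-j} k! C(k,j) / j!; hence s(k,j)/k! = (-1)^{k-j} C(k,j)/j!.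
module Submission where

open import Defs
open import Level using (Level; _⊔_)
open import Algebra.Bundles using (CommutativeRing)
open import Data.Nat as ℕ using (ℕ; zero; suc; _∸_; s≤s; z≤n)
import Data.Nat.Properties as ℕₚ
open import Data.Integer using (ℤ; +_)
import Data.Integer.Properties as ℤₚ
open import Data.Product using (_×_; _,_; proj₁; proj₂)
open import Data.List using (List; []; _∷_; _++_; map; upTo; applyUpTo; concatMap)
import Data.List.Properties as Listₚ
open import Data.List.Relation.Unary.All as All using (All; []; _∷_)
open import Data.List.Relation.Unary.All.Properties using (++⁺; map⁺)
open import Function using (_∘_)
open import Relation.Binary.Bundles using (Setoid)
open import Relation.Binary.PropositionalEquality as ≡ using (_≡_)
open import Relation.Nullary using (yes; no; ¬_; contradiction)
import Relation.Binary.Reasoning.Setoid as SetoidReasoning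

module FiniteSums {c ℓ} (R : CommutativeRing c ℓ) where
  open CommutativeRing R
  open import Algebra.Properties.CommutativeSemigroup +-commutativeSemigroup using (interchange)
  open SetoidReasoning setoid

  ∑< : ℕ → (ℕ → Carrier) → Carrier
  ∑< zero    f = 0#
  ∑< (suc n) f = ∑< n f + f n

  syntax ∑< n (λ i → e) = ∑[ i < n ] e

  ∑-cong< : ∀ n {f g} → (∀ i → i ℕ.< n → f i ≈ g i) → ∑< n f ≈ ∑< n g
  ∑-cong< zero    f≈g = refl
  ∑-cong< (suc n) f≈g =
    +-cong (∑-cong< n (λ i i<n → f≈g i (ℕₚ.m<n⇒m<1+n i<n))) (f≈g n (ℕₚ.n<1+n n))

  ∑-cong : ∀ n {f g} → (∀ i → f i ≈ g i) → ∑< n f ≈ ∑< n g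
  ∑-cong n f≈g = ∑-cong< n (λ i _ → f≈g i)

  ∑-zero : ∀ n → ∑[ i < n ] 0# ≈ 0#
  ∑-zero zero    = refl
  ∑-zero (suc n) = trans (+-identityʳ _) (∑-zero n)

  ∑-distrib-+ : ∀ n f g → ∑[ i < n ] (f i + g i) ≈ ∑< n f + ∑< n g
  ∑-distrib-+ zero    f g = sym (+-identityʳ 0#)
  ∑-distrib-+ (suc n) f g = trans (+-congʳ (∑-distrib-+ n f g)) (interchange _ _ _ _)

  ∑-distribˡ-* : ∀ n a f → ∑[ i < n ] (a * f i) ≈ a * ∑< n f
  ∑-distribˡ-* zero    a f = sym (zeroʳ a)
  ∑-distribˡ-* (suc n) a f = trans (+-congʳ (∑-distribˡ-* n a f)) (sym (distribˡ a _ _))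

  ∑-shift : ∀ n f → ∑< (suc n) f ≈ f 0 + ∑< n (f ∘ suc)
  ∑-shift zero    f = +-comm 0# (f 0)
  ∑-shift (suc n) f = trans (+-congʳ (∑-shift n f)) (+-assoc _ _ _)

  ∑-reverse : ∀ n f → ∑[ q < n ] f (n ∸ suc q) ≈ ∑< n f
  ∑-reverse zero    f = refl
  ∑-reverse (suc n) f = begin
    ∑[ q < n ] f (n ∸ q) + f (n ∸ n)
      ≈⟨ +-cong (∑-cong< n (λ q q<n → reflexive (≡.cong f (ℕₚ.+-∸-assoc 1 q<n))))
                (reflexive (≡.cong f (ℕₚ.n∸n≡0 n))) ⟩
    ∑[ q < n ] f (suc (n ∸ suc q)) + f 0 ≈⟨ +-congʳ (∑-reverse n (f ∘ suc)) ⟩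
    ∑< n (f ∘ suc) + f 0                ≈⟨ +-comm _ _ ⟩
    f 0 + ∑< n (f ∘ suc)                ≈⟨ ∑-shift n f ⟨
    ∑< (suc n) f                        ∎

  ∑-convolution : ∀ m (f g : ℕ → Carrier) →
    ∑[ n < m ] ∑[ q < n ] (f q * g (n ∸ suc q)) ≈ ∑[ q < m ] (f q * ∑< (m ∸ suc q) g)
  ∑-convolution zero    f g = refl
  ∑-convolution (suc m) f g = begin
    ∑[ n < m ] ∑[ q < n ] (f q * g (n ∸ suc q)) + ∑[ q < m ] (f q * g (m ∸ suc q))
      ≈⟨ +-congʳ (∑-convolution m f g) ⟩
    ∑[ q < m ] (f q * ∑< (m ∸ suc q) g) + ∑[ q < m ] (f q * g (m ∸ suc q))
      ≈⟨ ∑-distrib-+ m _ _ ⟨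
    ∑[ q < m ] (f q * ∑< (m ∸ suc q) g + f q * g (m ∸ suc q))
      ≈⟨ ∑-cong< m (λ q q<m → trans (sym (distribˡ _ _ _))
           (*-congˡ (reflexive (≡.cong (λ n → ∑< n g) (≡.sym (ℕₚ.+-∸-assoc 1 q<m)))))) ⟩
    ∑[ q < m ] (f q * ∑< (m ∸ q) g)
      ≈⟨ +-identityʳ _ ⟨
    ∑[ q < m ] (f q * ∑< (m ∸ q) g) + 0#
      ≈⟨ +-congˡ (trans (*-congˡ (reflexive (≡.cong (λ n → ∑< n g) (ℕₚ.n∸n≡0 m)))) (zeroʳ _)) ⟨
    ∑[ q < m ] (f q * ∑< (m ∸ q) g) + f m * ∑< (m ∸ m) g
      ∎

data Is₀₁ : ℤ → Set where
  is₀ : Is₀₁ (+ 0)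
  is₁ : Is₀₁ (+ 1)

module _ {c ℓ} (A : QAlgebra c ℓ) where
  open Construction A
  open FiniteSums cring
  open import Algebra.Properties.Ring ring using (-‿distribˡ-*; -‿distribʳ-*; -0#≈0#)
  open import Algebra.Properties.AbelianGroup +-abelianGroup using (⁻¹-∙-comm)
  import Algebra.Properties.CommutativeSemigroup *-commutativeSemigroup as *-CS
  import Algebra.Properties.CommutativeSemigroup +-commutativeSemigroup as +-CS
  open import Algebra.Solver.Ring.NaturalCoefficients.Default commutativeSemiring
    using (solve; _:=_; _:+_; _:*_)

  module ≈-Reasoning = SetoidReasoning setoid

  fromℕ-+ : ∀ m n → fromℕ (m ℕ.+ n) ≈ fromℕ m + fromℕ n
  fromℕ-+ zero    n = sym (+-identityˡ _)
  fromℕ-+ (suc m) n = trans (+-congˡ (fromℕ-+ m n)) (sym (+-assoc _ _ _))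

  -x-1≈-[1+x] : ∀ x → - x - 1# ≈ - (1# + x)
  -x-1≈-[1+x] x = trans (⁻¹-∙-comm x 1#) (-‿cong (+-comm x 1#))

  [x-y]-1≈x-[1+y] : ∀ x y → (x - y) - 1# ≈ x - (1# + y)
  [x-y]-1≈x-[1+y] x y = trans (+-assoc x (- y) (- 1#)) (+-congˡ (-x-1≈-[1+x] y))

  private
    xy*-z≈x*-[zy] : ∀ x y z → (x * y) * (- z) ≈ x * (- (z * y))
    xy*-z≈x*-[zy] x y z =
      trans (*-assoc x y (- z)) (*-congˡ (trans (*-comm y (- z)) (sym (-‿distribˡ-* z y))))

    [xs]y+[[xy]t]w≈[xy][s+wt] : ∀ x y s t w →
      (x * s) * y + ((x * y) * t) * w ≈ (x * y) * (s + w * t)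
    [xs]y+[[xy]t]w≈[xy][s+wt] = solve 5 (λ x y s t w →
      (x :* s) :* y :+ ((x :* y) :* t) :* w := (x :* y) :* (s :+ w :* t)) refl

    [a+b][cx]≈[ac]x+c[bx] : ∀ a b c x → (a + b) * (c * x) ≈ (a * c) * x + c * (b * x)
    [a+b][cx]≈[ac]x+c[bx] =
      solve 4 (λ a b c x → (a :+ b) :* (c :* x) := (a :* c) :* x :+ c :* (b :* x)) refl

    s[ab+cd]≈a[sb]+c[sd] : ∀ s a b c d → s * (a * b + c * d) ≈ a * (s * b) + c * (s * d)
    s[ab+cd]≈a[sb]+c[sd] = solve 5 (λ s a b c d →
      s :* (a :* b :+ c :* d) := a :* (s :* b) :+ c :* (s :* d)) refl

    [xv][a+wb]≈v[xa+w[xb]] : ∀ x v a w b → (x * v) * (a + w * b) ≈ v * (x * a + w * (x * b))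
    [xv][a+wb]≈v[xa+w[xb]] = solve 5 (λ x v a w b →
      (x :* v) :* (a :+ w :* b) := v :* (x :* a :+ w :* (x :* b))) refl

    [xy]a+w[xb]≈x[ya+wb] : ∀ x y a w b → (x * y) * a + w * (x * b) ≈ x * (y * a + w * b)
    [xy]a+w[xb]≈x[ya+wb] = solve 5 (λ x y a w b →
      (x :* y) :* a :+ w :* (x :* b) := x :* (y :* a :+ w :* b)) refl

    v[x[ya]]≈[yv][xa] : ∀ v x y a → v * (x * (y * a)) ≈ (y * v) * (x * a)
    v[x[ya]]≈[yv][xa] = solve 4 (λ v x y a → v :* (x :* (y :* a)) := (y :* v) :* (x :* a)) refl

  sumC-++ : ∀ xs ys → sumC (xs ++ ys) ≈ sumC xs + sumC ys
  sumC-++ []       ys = sym (+-identityˡ _)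
  sumC-++ (x ∷ xs) ys = trans (+-congˡ (sumC-++ xs ys)) (sym (+-assoc _ _ _))

  sumC-applyUpTo : ∀ n f → sumC (applyUpTo f n) ≈ ∑< n f
  sumC-applyUpTo zero    f = refl
  sumC-applyUpTo (suc n) f = trans (+-congˡ (sumC-applyUpTo n (f ∘ suc))) (sym (∑-shift n f))

  prod-++ : ∀ xs ys → prod (xs ++ ys) ≈ prod xs * prod ys
  prod-++ []       ys = sym (*-identityˡ _)
  prod-++ (x ∷ xs) ys = trans (*-congˡ (prod-++ xs ys)) (sym (*-assoc _ _ _))

  prod-map-upTo-suc : ∀ f n → prod (map f (upTo (suc n))) ≈ prod (map f (upTo n)) * f n
  prod-map-upTo-suc f n = begin
    prod (map f (upTo (suc n)))           ≡⟨ ≡.cong (prod ∘ map f) (Listₚ.upTo-∷ʳ n) ⟨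
    prod (map f (upTo n ++ n ∷ []))        ≡⟨ ≡.cong prod (Listₚ.map-++ f (upTo n) (n ∷ [])) ⟩
    prod (map f (upTo n) ++ f n ∷ [])      ≈⟨ prod-++ (map f (upTo n)) (f n ∷ []) ⟩
    prod (map f (upTo n)) * (f n * 1#)     ≈⟨ *-congˡ (*-identityʳ (f n)) ⟩
    prod (map f (upTo n)) * f n            ∎
    where open ≈-Reasoning

  invFact-suc : ∀ n → invFact (suc n) ≈ invFact n * inv n
  invFact-suc = prod-map-upTo-suc inv

  invFact≈invFact-suc*[1+n] : ∀ n → invFact n ≈ invFact (suc n) * fromℕ (suc n)
  invFact≈invFact-suc*[1+n] n = begin
    invFact n                                ≈⟨ *-identityʳ _ ⟨
    invFact n * 1#                           ≈⟨ *-congˡ (trans (*-comm _ _) (inv-spec n)) ⟨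
    invFact n * (inv n * fromℕ (suc n))      ≈⟨ *-assoc _ _ _ ⟨
    invFact n * inv n * fromℕ (suc n)        ≈⟨ *-congʳ (invFact-suc n) ⟨
    invFact (suc n) * fromℕ (suc n)          ∎
    where open ≈-Reasoning

  falling : Carrier → ℕ → Carrier
  falling r j = prod (map (λ i → r - fromℕ i) (upTo j))

  falling-suc : ∀ r j → falling r (suc j) ≈ falling r j * (r - fromℕ j)
  falling-suc r = prod-map-upTo-suc (λ i → r - fromℕ i)

  -- Polynomials up to ∼

  ∼-setoid : Setoid c (c ⊔ ℓ)
  ∼-setoid = record
    { Carrier       = Poly
    ; _≈_           = _∼_
    ; isEquivalence = record { refl = ∼-refl ; sym = ∼-sym ; trans = ∼-trans }
    }

  module ∼-Reasoning = SetoidReasoning ∼-setoid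

  ≋-refl : ∀ {m} → m ≋ m
  ≋-refl i = refl

  ≋-∷ : ∀ {j r r' m m'} → r ≈ r' → m ≋ m' → ((j , r) ∷ m) ≋ ((j , r') ∷ m')
  ≋-∷ {j} r≈r' e i with j ℤₚ.≟ i
  ... | yes _ = +-cong r≈r' (e i)
  ... | no  _ = e i

  ·m-congˡ : ∀ n {m m'} → m ≋ m' → (n ·m m) ≋ (n ·m m')
  ·m-congˡ []      e = e
  ·m-congˡ ((j , r) ∷ n) {m} {m'} e = ≋-∷ {j} {r} {r} {n ·m m} {n ·m m'} refl (·m-congˡ n e)

  ∷-cong : ∀ {t p q} → p ∼ q → t ∷ p ∼ t ∷ q
  ∷-cong {_ , m} = ∼-cons refl (≋-refl {m})

  ++-congˡ : ∀ xs {p q} → p ∼ q → xs ++ p ∼ xs ++ q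
  ++-congˡ []       p∼q = p∼q
  ++-congˡ (_ ∷ xs) p∼q = ∷-cong (++-congˡ xs p∼q)

  ++-congʳ : ∀ ys {p q} → p ∼ q → p ++ ys ∼ q ++ ys
  ++-congʳ ys ∼-refl           = ∼-refl
  ++-congʳ ys (∼-sym h)        = ∼-sym (++-congʳ ys h)
  ++-congʳ ys (∼-trans h h')   = ∼-trans (++-congʳ ys h) (++-congʳ ys h')
  ++-congʳ ys (∼-cons a≈ m≋ h) = ∼-cons a≈ m≋ (++-congʳ ys h)
  ++-congʳ ys ∼-swap           = ∼-swap
  ++-congʳ ys ∼-merge          = ∼-merge
  ++-congʳ ys ∼-zero           = ∼-zero

  ++-cong : ∀ {p p' q q'} → p ∼ p' → q ∼ q' → p ++ q ∼ p' ++ q'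
  ++-cong {p' = p'} p∼p' q∼q' = ∼-trans (++-congʳ _ p∼p') (++-congˡ p' q∼q')

  ∼-dropZero : ∀ {a m p} → a ≈ 0# → (a , m) ∷ p ∼ p
  ∼-dropZero {m = m} a≈0 = ∼-trans (∼-cons {m = m} {m} a≈0 (≋-refl {m}) ∼-refl) ∼-zero

  scale-cong : ∀ a {p q} → p ∼ q → scale a p ∼ scale a q
  scale-cong a ∼-refl            = ∼-refl
  scale-cong a (∼-sym h)         = ∼-sym (scale-cong a h)
  scale-cong a (∼-trans h h')    = ∼-trans (scale-cong a h) (scale-cong a h')
  scale-cong a (∼-cons b≈ m≋ h)  = ∼-cons (*-congˡ b≈) m≋ (scale-cong a h)
  scale-cong a ∼-swap            = ∼-swap
  scale-cong a (∼-merge {m = m}) =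
    ∼-trans ∼-merge (∼-cons (sym (distribˡ a _ _)) (≋-refl {m}) ∼-refl)
  scale-cong a ∼-zero            = ∼-dropZero (zeroʳ a)

  mulMono-cong : ∀ n {p q} → p ∼ q → mulMono n p ∼ mulMono n q
  mulMono-cong n ∼-refl           = ∼-refl
  mulMono-cong n (∼-sym h)        = ∼-sym (mulMono-cong n h)
  mulMono-cong n (∼-trans h h')   = ∼-trans (mulMono-cong n h) (mulMono-cong n h')
  mulMono-cong n (∼-cons a≈ m≋ h) = ∼-cons a≈ (·m-congˡ n m≋) (mulMono-cong n h)
  mulMono-cong n ∼-swap           = ∼-swap
  mulMono-cong n ∼-merge          = ∼-merge
  mulMono-cong n ∼-zero           = ∼-zero

  applyUpTo-cong : ∀ n {F G : ℕ → Carrier × Mono} →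
    (∀ j → proj₁ (F j) ≈ proj₁ (G j)) → (∀ j → proj₂ (F j) ≋ proj₂ (G j)) →
    applyUpTo F n ∼ applyUpTo G n
  applyUpTo-cong zero    _  _  = ∼-refl
  applyUpTo-cong (suc n) a≈ m≋ = ∼-cons (a≈ 0) (m≋ 0) (applyUpTo-cong n (a≈ ∘ suc) (m≋ ∘ suc))

  -- Monomials in ℓ₀ and ℓ₁ and their derivatives

  Mono₀₁ : Mono → Set c
  Mono₀₁ = All (Is₀₁ ∘ proj₁)

  Poly₀₁ : Poly → Set c
  Poly₀₁ = All (Mono₀₁ ∘ proj₂)

  infix 25 ℓ₁^_ℓ₀^_
  ℓ₁^_ℓ₀^_ : Carrier → Carrier → Mono
  ℓ₁^ a ℓ₀^ b = (+ 1 , a) ∷ (+ 0 , b) ∷ []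

  ℓ₁^ℓ₀^-Mono₀₁ : ∀ {a b} → Mono₀₁ (ℓ₁^ a ℓ₀^ b)
  ℓ₁^ℓ₀^-Mono₀₁ = is₁ ∷ is₀ ∷ []

  ℓ₁^ℓ₀^-cong : ∀ {a a' b b'} → a ≈ a' → b ≈ b' → ℓ₁^ a ℓ₀^ b ≋ ℓ₁^ a' ℓ₀^ b'
  ℓ₁^ℓ₀^-cong {b = b} {b'} a≈a' b≈b' =
    ≋-∷ {+ 1} {m = (+ 0 , b) ∷ []} {(+ 0 , b') ∷ []} a≈a'
        (≋-∷ {+ 0} {m = []} {[]} b≈b' (≋-refl {[]}))

  expo-Mono₀₁ : ∀ {m i} → Mono₀₁ m → ¬ i ≡ + 1 → ¬ i ≡ + 0 → expo m i ≈ 0#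
  expo-Mono₀₁ []                          i≢1 i≢0 = refl
  expo-Mono₀₁ {(j , _) ∷ _} {i} (_ ∷ m₀₁) i≢1 i≢0 with j ℤₚ.≟ i
  expo-Mono₀₁ (is₀ ∷ _) i≢1 i≢0 | yes ≡.refl = contradiction ≡.refl i≢0
  expo-Mono₀₁ (is₁ ∷ _) i≢1 i≢0 | yes ≡.refl = contradiction ≡.refl i≢1
  ... | no _ = expo-Mono₀₁ m₀₁ i≢1 i≢0

  Mono₀₁-≋ : ∀ {m a b} → Mono₀₁ m → expo m (+ 1) ≈ a → expo m (+ 0) ≈ b → m ≋ ℓ₁^ a ℓ₀^ b
  Mono₀₁-≋ m₀₁ e₁ e₀ i with i ℤₚ.≟ + 1 | i ℤₚ.≟ + 0
  ... | yes ≡.refl | _          = trans e₁ (sym (+-identityʳ _))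
  ... | no _       | yes ≡.refl = trans e₀ (sym (+-identityʳ _))
  ... | no i≢1     | no i≢0     =
    trans (expo-Mono₀₁ m₀₁ i≢1 i≢0) (sym (expo-Mono₀₁ ℓ₁^ℓ₀^-Mono₀₁ i≢1 i≢0))

  ℓ₁·ℓ₁^ℓ₀^ : ∀ s a b {a'} → s + a ≈ a' → ((+ 1 , s) ∷ ℓ₁^ a ℓ₀^ b) ≋ ℓ₁^ a' ℓ₀^ b
  ℓ₁·ℓ₁^ℓ₀^ s a b s+a≈a' =
    Mono₀₁-≋ (is₁ ∷ ℓ₁^ℓ₀^-Mono₀₁) (trans (+-congˡ (+-identityʳ a)) s+a≈a') (+-identityʳ b)

  ℓ₀·ℓ₁^ℓ₀^ : ∀ s a b {b'} → s + b ≈ b' → ((+ 0 , s) ∷ ℓ₁^ a ℓ₀^ b) ≋ ℓ₁^ a ℓ₀^ b'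
  ℓ₀·ℓ₁^ℓ₀^ s a b s+b≈b' =
    Mono₀₁-≋ (is₀ ∷ ℓ₁^ℓ₀^-Mono₀₁) (+-identityʳ a) (trans (+-congˡ (+-identityʳ b)) s+b≈b')

  d₀₁ : Carrier → Carrier → Poly
  d₀₁ a b = (a , ℓ₁^ (a - 1#) ℓ₀^ (b - 1#)) ∷ (b , ℓ₁^ a ℓ₀^ (b - 1#)) ∷ []

  dMono≈d₀₁ : ∀ {m} → Mono₀₁ m → dMono m ∼ d₀₁ (expo m (+ 1)) (expo m (+ 0))
  dMono≈d₀₁ [] = ∼-sym (∼-trans ∼-zero ∼-zero)
  dMono≈d₀₁ {(_ , s) ∷ m} (is₁ ∷ m₀₁) = begin
    (s , (+ 1 , s - 1#) ∷ (+ 0 , - 1#) ∷ m) ∷ mulMono ((+ 1 , s) ∷ []) (dMono m)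
      ≈⟨ ∷-cong (mulMono-cong _ (dMono≈d₀₁ m₀₁)) ⟩
    (s , (+ 1 , s - 1#) ∷ (+ 0 , - 1#) ∷ m)
      ∷ (α , (+ 1 , s) ∷ ℓ₁^ (α - 1#) ℓ₀^ (β - 1#)) ∷ (β , (+ 1 , s) ∷ ℓ₁^ α ℓ₀^ (β - 1#)) ∷ []
      ≈⟨ ∼-cons refl (Mono₀₁-≋ (is₁ ∷ is₀ ∷ m₀₁) (+-CS.xy∙z≈xz∙y s (- 1#) α) (+-comm (- 1#) β))
           (∼-cons refl (ℓ₁·ℓ₁^ℓ₀^ s (α - 1#) (β - 1#) (sym (+-assoc s α (- 1#))))
           (∼-cons refl (ℓ₁·ℓ₁^ℓ₀^ s α (β - 1#) refl) ∼-refl)) ⟩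
    (s , ℓ₁^ ((s + α) - 1#) ℓ₀^ (β - 1#)) ∷ (α , ℓ₁^ ((s + α) - 1#) ℓ₀^ (β - 1#))
      ∷ (β , ℓ₁^ (s + α) ℓ₀^ (β - 1#)) ∷ []
      ≈⟨ ∼-merge ⟩
    d₀₁ (s + α) β ∎
    where
      open ∼-Reasoning
      α = expo m (+ 1)
      β = expo m (+ 0)
  dMono≈d₀₁ {(_ , s) ∷ m} (is₀ ∷ m₀₁) = begin
    (s , (+ 0 , s - 1#) ∷ m) ∷ mulMono ((+ 0 , s) ∷ []) (dMono m)
      ≈⟨ ∷-cong (mulMono-cong _ (dMono≈d₀₁ m₀₁)) ⟩
    (s , (+ 0 , s - 1#) ∷ m)
      ∷ (α , (+ 0 , s) ∷ ℓ₁^ (α - 1#) ℓ₀^ (β - 1#)) ∷ (β , (+ 0 , s) ∷ ℓ₁^ α ℓ₀^ (β - 1#)) ∷ []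
      ≈⟨ ∼-swap ⟩
    (α , (+ 0 , s) ∷ ℓ₁^ (α - 1#) ℓ₀^ (β - 1#)) ∷ (s , (+ 0 , s - 1#) ∷ m)
      ∷ (β , (+ 0 , s) ∷ ℓ₁^ α ℓ₀^ (β - 1#)) ∷ []
      ≈⟨ ∼-cons refl (ℓ₀·ℓ₁^ℓ₀^ s (α - 1#) (β - 1#) (sym (+-assoc s β (- 1#))))
           (∼-cons refl (Mono₀₁-≋ (is₀ ∷ m₀₁) refl (+-CS.xy∙z≈xz∙y s (- 1#) β))
           (∼-cons refl (ℓ₀·ℓ₁^ℓ₀^ s α (β - 1#) (sym (+-assoc s β (- 1#)))) ∼-refl)) ⟩
    (α , ℓ₁^ (α - 1#) ℓ₀^ ((s + β) - 1#)) ∷ (s , ℓ₁^ α ℓ₀^ ((s + β) - 1#))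
      ∷ (β , ℓ₁^ α ℓ₀^ ((s + β) - 1#)) ∷ []
      ≈⟨ ∷-cong ∼-merge ⟩
    d₀₁ α (s + β) ∎
    where
      open ∼-Reasoning
      α = expo m (+ 1)
      β = expo m (+ 0)

  -- d/dx computed through the exponents of ℓ₁ and ℓ₀ only; unlike D, it respects ∼.
  D₀₁ : Poly → Poly
  D₀₁ []            = []
  D₀₁ ((a , m) ∷ p) = scale a (d₀₁ (expo m (+ 1)) (expo m (+ 0))) ++ D₀₁ p

  D≈D₀₁ : ∀ {p} → Poly₀₁ p → D p ∼ D₀₁ p
  D≈D₀₁ []                       = ∼-refl
  D≈D₀₁ {(a , _) ∷ _} (m₀₁ ∷ p₀₁) = ++-cong (scale-cong a (dMono≈d₀₁ m₀₁)) (D≈D₀₁ p₀₁)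

  D₀₁-cong : ∀ {p q} → p ∼ q → D₀₁ p ∼ D₀₁ q
  D₀₁-cong ∼-refl         = ∼-refl
  D₀₁-cong (∼-sym h)      = ∼-sym (D₀₁-cong h)
  D₀₁-cong (∼-trans h h') = ∼-trans (D₀₁-cong h) (D₀₁-cong h')
  D₀₁-cong (∼-cons a≈a' m≋m' h) =
    ∼-cons (*-cong a≈a' (m≋m' (+ 1)))
           (ℓ₁^ℓ₀^-cong (+-congʳ (m≋m' (+ 1))) (+-congʳ (m≋m' (+ 0))))
    (∼-cons (*-cong a≈a' (m≋m' (+ 0)))
            (ℓ₁^ℓ₀^-cong (m≋m' (+ 1)) (+-congʳ (m≋m' (+ 0))))
    (D₀₁-cong h))
  D₀₁-cong ∼-swap =
    ∼-trans (∷-cong ∼-swap) (∼-trans ∼-swap (∼-trans (∷-cong (∷-cong ∼-swap)) (∷-cong ∼-swap)))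
  D₀₁-cong (∼-merge {m = m}) =
    ∼-trans (∷-cong ∼-swap) (∼-trans ∼-merge (∼-trans (∷-cong ∼-merge)
      (∼-cons (sym (distribʳ _ _ _)) (≋-refl {M₁})
        (∼-cons (sym (distribʳ _ _ _)) (≋-refl {M₀}) ∼-refl))))
    where
      M₁ = ℓ₁^ (expo m (+ 1) - 1#) ℓ₀^ (expo m (+ 0) - 1#)
      M₀ = ℓ₁^ (expo m (+ 1)) ℓ₀^ (expo m (+ 0) - 1#)
  D₀₁-cong ∼-zero = ∼-trans (∼-dropZero (zeroˡ _)) (∼-dropZero (zeroˡ _))

  dfac-Mono₀₁ : ∀ {i} → Is₀₁ i → Mono₀₁ (dfac i)
  dfac-Mono₀₁ is₀ = []
  dfac-Mono₀₁ is₁ = is₀ ∷ []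

  dMono-Poly₀₁ : ∀ {m} → Mono₀₁ m → Poly₀₁ (dMono m)
  dMono-Poly₀₁ []          = []
  dMono-Poly₀₁ (i∈ ∷ m₀₁) =
    (i∈ ∷ ++⁺ (dfac-Mono₀₁ i∈) m₀₁) ∷ map⁺ (All.map (++⁺ (i∈ ∷ [])) (dMono-Poly₀₁ m₀₁))

  D-Poly₀₁ : ∀ {p} → Poly₀₁ p → Poly₀₁ (D p)
  D-Poly₀₁ []          = []
  D-Poly₀₁ (m₀₁ ∷ p₀₁) = ++⁺ (map⁺ (dMono-Poly₀₁ m₀₁)) (D-Poly₀₁ p₀₁)

  Dⁿ-Poly₀₁ : ∀ k {p} → Poly₀₁ p → Poly₀₁ (Dⁿ k p)
  Dⁿ-Poly₀₁ zero    p₀₁ = p₀₁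
  Dⁿ-Poly₀₁ (suc k) p₀₁ = D-Poly₀₁ (Dⁿ-Poly₀₁ k p₀₁)

  -- Iterated derivatives of ℓ₁^r

  interleave : ℕ → (ℕ → Carrier) → (ℕ → Carrier) → (ℕ → Mono) → Poly
  interleave zero    f g M = []
  interleave (suc n) f g M =
    (f 0 , M 1) ∷ (g 0 , M 0) ∷ interleave n (f ∘ suc) (g ∘ suc) (M ∘ suc)

  interleave-telescopes : ∀ n f g M → g n ≈ 0# →
    interleave n f g M ∼ (g 0 , M 0) ∷ applyUpTo (λ j → (f j + g (suc j) , M (suc j))) n
  interleave-telescopes zero    f g M g₀≈0 = ∼-sym (∼-dropZero g₀≈0)
  interleave-telescopes (suc n) f g M gₙ≈0 = begin
    (f 0 , M 1) ∷ (g 0 , M 0) ∷ interleave n (f ∘ suc) (g ∘ suc) (M ∘ suc)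
      ≈⟨ ∷-cong (∷-cong (interleave-telescopes n (f ∘ suc) (g ∘ suc) (M ∘ suc) gₙ≈0)) ⟩
    (f 0 , M 1) ∷ (g 0 , M 0) ∷ (g 1 , M 1) ∷ rest  ≈⟨ ∼-swap ⟩
    (g 0 , M 0) ∷ (f 0 , M 1) ∷ (g 1 , M 1) ∷ rest  ≈⟨ ∷-cong ∼-merge ⟩
    (g 0 , M 0) ∷ (f 0 + g 1 , M 1) ∷ rest          ∎
    where
      open ∼-Reasoning
      rest = applyUpTo (λ j → (f (suc j) + g (suc (suc j)) , M (suc (suc j)))) n

  D₀₁-applyUpTo : ∀ n b (c a : ℕ → Carrier) → (∀ j → a j - 1# ≈ a (suc j)) →
    D₀₁ (applyUpTo (λ j → (c j , ℓ₁^ (a j) ℓ₀^ b)) n)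
      ∼ interleave n (λ j → c j * a j) (λ j → c j * b) (λ j → ℓ₁^ (a j) ℓ₀^ (b - 1#))
  D₀₁-applyUpTo zero    b c a a-1≈a' = ∼-refl
  D₀₁-applyUpTo (suc n) b c a a-1≈a' =
    ∼-cons (*-congˡ (+-identityʳ (a 0)))
           (ℓ₁^ℓ₀^-cong (trans (+-congʳ (+-identityʳ (a 0))) (a-1≈a' 0)) (+-congʳ (+-identityʳ b)))
    (∼-cons (*-congˡ (+-identityʳ b))
            (ℓ₁^ℓ₀^-cong (+-identityʳ (a 0)) (+-congʳ (+-identityʳ b)))
    (D₀₁-applyUpTo n b (c ∘ suc) (a ∘ suc) (a-1≈a' ∘ suc)))

  stirling₁ : ℕ → ℕ → Carrier
  stirling₁ zero    zero    = 1#
  stirling₁ zero    (suc j) = 0#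
  stirling₁ (suc k) zero    = 0#
  stirling₁ (suc k) (suc j) = stirling₁ k j - fromℕ k * stirling₁ k (suc j)

  stirling₁-vanishes : ∀ {k j} → k ℕ.< j → stirling₁ k j ≈ 0#
  stirling₁-vanishes {zero}  {suc j} _         = refl
  stirling₁-vanishes {suc k} {suc j} (s≤s k<j) = begin
    stirling₁ k j - fromℕ k * stirling₁ k (suc j)
      ≈⟨ +-cong (stirling₁-vanishes k<j)
                (-‿cong (*-congˡ (stirling₁-vanishes (ℕₚ.m<n⇒m<1+n k<j)))) ⟩
    0# - fromℕ k * 0#  ≈⟨ +-identityˡ _ ⟩
    - (fromℕ k * 0#)   ≈⟨ -‿cong (zeroʳ _) ⟩
    - 0#               ≈⟨ -0#≈0# ⟩
    0#                 ∎
    where open ≈-Reasoning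

  k*stirling₁[k,0]≈0 : ∀ k → fromℕ k * stirling₁ k 0 ≈ 0#
  k*stirling₁[k,0]≈0 zero    = zeroˡ 1#
  k*stirling₁[k,0]≈0 (suc k) = zeroʳ _

  module _ (r : Carrier) where

    DⁿTerm : ℕ → ℕ → Carrier × Mono
    DⁿTerm k j = (falling r j * stirling₁ k j , ℓ₁^ (r - fromℕ j) ℓ₀^ (- fromℕ k))

    DⁿTerms : ℕ → Poly
    DⁿTerms k = applyUpTo (DⁿTerm k) (suc k)

    falling*stirling₁-zero : ∀ k →
      (falling r 0 * stirling₁ k 0) * (- fromℕ k) ≈ falling r 0 * stirling₁ (suc k) 0
    falling*stirling₁-zero k = trans (xy*-z≈x*-[zy] _ _ (fromℕ k))
      (*-congˡ (trans (-‿cong (k*stirling₁[k,0]≈0 k)) -0#≈0#))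

    falling*stirling₁-suc : ∀ k j →
      (falling r j * stirling₁ k j) * (r - fromℕ j)
        + (falling r (suc j) * stirling₁ k (suc j)) * (- fromℕ k)
      ≈ falling r (suc j) * stirling₁ (suc k) (suc j)
    falling*stirling₁-suc k j = begin
      (falling r j * stirling₁ k j) * (r - fromℕ j)
        + (falling r (suc j) * stirling₁ k (suc j)) * (- fromℕ k)
        ≈⟨ +-congˡ (*-congʳ (*-congʳ (falling-suc r j))) ⟩
      (falling r j * stirling₁ k j) * (r - fromℕ j)
        + ((falling r j * (r - fromℕ j)) * stirling₁ k (suc j)) * (- fromℕ k)
        ≈⟨ [xs]y+[[xy]t]w≈[xy][s+wt] _ _ _ _ _ ⟩
      (falling r j * (r - fromℕ j)) * (stirling₁ k j + (- fromℕ k) * stirling₁ k (suc j))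
        ≈⟨ *-congˡ (+-congˡ (-‿distribˡ-* _ _)) ⟨
      (falling r j * (r - fromℕ j)) * (stirling₁ k j - fromℕ k * stirling₁ k (suc j))
        ≈⟨ *-congʳ (falling-suc r j) ⟨
      falling r (suc j) * stirling₁ (suc k) (suc j) ∎
      where open ≈-Reasoning

    D₀₁-DⁿTerms : ∀ k → D₀₁ (DⁿTerms k) ∼ DⁿTerms (suc k)
    D₀₁-DⁿTerms k = begin
      D₀₁ (DⁿTerms k)
        ≈⟨ D₀₁-applyUpTo (suc k) (- K) cₖ (λ j → r - fromℕ j)
                         (λ j → [x-y]-1≈x-[1+y] r (fromℕ j)) ⟩
      interleave (suc k) f g M
        ≈⟨ interleave-telescopes (suc k) f g M lastVanishes ⟩
      (g 0 , M 0) ∷ applyUpTo (λ j → (f j + g (suc j) , M (suc j))) (suc k)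
        ≈⟨ ∼-cons (falling*stirling₁-zero k) (ℓ₁^ℓ₀^-cong refl (-x-1≈-[1+x] K))
             (applyUpTo-cong (suc k) {λ j → (f j + g (suc j) , M (suc j))} {DⁿTerm (suc k) ∘ suc}
                (falling*stirling₁-suc k) (λ j → ℓ₁^ℓ₀^-cong refl (-x-1≈-[1+x] K))) ⟩
      DⁿTerms (suc k) ∎
      where
        open ∼-Reasoning
        K = fromℕ k
        cₖ f g : ℕ → Carrier
        cₖ j = falling r j * stirling₁ k j
        f j = cₖ j * (r - fromℕ j)
        g j = cₖ j * (- K)
        M : ℕ → Mono
        M j = ℓ₁^ (r - fromℕ j) ℓ₀^ (- K - 1#)

        lastVanishes : g (suc k) ≈ 0#
        lastVanishes =
          trans (*-congʳ (trans (*-congˡ (stirling₁-vanishes (ℕₚ.n<1+n k))) (zeroʳ _))) (zeroˡ _)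

    Dⁿ-ℓ₁^ : ∀ k → Dⁿ k (ℓ₁^ r) ∼ DⁿTerms k
    Dⁿ-ℓ₁^ zero = ∼-cons (sym (*-identityˡ 1#))
      (Mono₀₁-≋ (is₁ ∷ []) (+-congˡ (sym -0#≈0#)) (sym -0#≈0#)) ∼-refl
    Dⁿ-ℓ₁^ (suc k) = begin
      D (Dⁿ k (ℓ₁^ r))     ≈⟨ D≈D₀₁ (Dⁿ-Poly₀₁ k ((is₁ ∷ []) ∷ [])) ⟩
      D₀₁ (Dⁿ k (ℓ₁^ r))   ≈⟨ D₀₁-cong (Dⁿ-ℓ₁^ k) ⟩
      D₀₁ (DⁿTerms k)      ≈⟨ D₀₁-DⁿTerms k ⟩
      DⁿTerms (suc k)      ∎
      where open ∼-Reasoning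

  -- Composition sums

  -- Parts of compositions are stored decremented, so the weight of a part q is 1/(q+1).
  weight : List ℕ → Carrier
  weight = prod ∘ map inv

  sumC-prepend : ∀ q L → sumC (map weight (map (q ∷_) L)) ≈ inv q * sumC (map weight L)
  sumC-prepend q []      = sym (zeroʳ _)
  sumC-prepend q (l ∷ L) = trans (+-congˡ (sumC-prepend q L)) (sym (distribˡ _ _ _))

  sumC-concatMap-prepend : ∀ (G : ℕ → List (List ℕ)) L →
    sumC (map weight (concatMap (λ q → map (q ∷_) (G q)) L))
      ≈ sumC (map (λ q → inv q * sumC (map weight (G q))) L)
  sumC-concatMap-prepend G []      = refl
  sumC-concatMap-prepend G (q ∷ L) = begin
    sumC (map weight (map (q ∷_) (G q) ++ rest))
      ≡⟨ ≡.cong sumC (Listₚ.map-++ weight (map (q ∷_) (G q)) rest) ⟩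
    sumC (map weight (map (q ∷_) (G q)) ++ map weight rest)
      ≈⟨ sumC-++ (map weight (map (q ∷_) (G q))) (map weight rest) ⟩
    sumC (map weight (map (q ∷_) (G q))) + sumC (map weight rest)
      ≈⟨ +-cong (sumC-prepend q (G q)) (sumC-concatMap-prepend G L) ⟩
    inv q * sumC (map weight (G q)) + sumC (map (λ q → inv q * sumC (map weight (G q))) L) ∎
    where
      open ≈-Reasoning
      rest = concatMap (λ q → map (q ∷_) (G q)) L

  compSum-suc : ∀ m j → compSum m (suc j) ≈ ∑[ q < m ] (inv q * compSum (m ∸ suc q) j)
  compSum-suc zero    j = refl
  compSum-suc (suc m) j = begin
    compSum (suc m) (suc j)
      ≈⟨ sumC-concatMap-prepend (λ q → comps (suc m ∸ suc q) j) (upTo (suc m)) ⟩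
    sumC (map (λ q → inv q * compSum (suc m ∸ suc q) j) (upTo (suc m)))
      ≡⟨ ≡.cong sumC (Listₚ.map-upTo _ (suc m)) ⟩
    sumC (applyUpTo (λ q → inv q * compSum (suc m ∸ suc q) j) (suc m))
      ≈⟨ sumC-applyUpTo (suc m) _ ⟩
    ∑[ q < suc m ] (inv q * compSum (suc m ∸ suc q) j) ∎
    where open ≈-Reasoning

  compSum-vanishes : ∀ {m j} → m ℕ.< j → compSum m j ≈ 0#
  compSum-vanishes {m} {suc j} (s≤s m≤j) = begin
    compSum m (suc j)                         ≈⟨ compSum-suc m j ⟩
    ∑[ q < m ] (inv q * compSum (m ∸ suc q) j) ≈⟨ ∑-cong< m vanishingTerm ⟩
    ∑[ q < m ] 0#                             ≈⟨ ∑-zero m ⟩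
    0#                                        ∎
    where
      open ≈-Reasoning
      vanishingTerm : ∀ q → q ℕ.< m → inv q * compSum (m ∸ suc q) j ≈ 0#
      vanishingTerm q q<m = trans (*-congˡ (compSum-vanishes
        (ℕₚ.<-≤-trans (ℕₚ.∸-monoʳ-< (s≤s z≤n) q<m) m≤j))) (zeroʳ _)

  compSum-zero-zero : compSum 0 0 ≈ 1#
  compSum-zero-zero = +-identityʳ 1#

  n*compSum[n,0]≈0 : ∀ n → fromℕ n * compSum n 0 ≈ 0#
  n*compSum[n,0]≈0 zero    = zeroˡ _
  n*compSum[n,0]≈0 (suc n) = zeroʳ _

  -- m = (q+1) + (m - q - 1), and (q+1)/(q+1) = 1.
  m*inv[q]x≈x+inv[q][m-q-1]x : ∀ m q x → q ℕ.< m →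
    fromℕ m * (inv q * x) ≈ x + inv q * (fromℕ (m ∸ suc q) * x)
  m*inv[q]x≈x+inv[q][m-q-1]x m q x q<m = begin
    fromℕ m * (inv q * x)
      ≡⟨ ≡.cong (λ n → fromℕ n * (inv q * x)) (ℕₚ.m+[n∸m]≡n q<m) ⟨
    fromℕ (suc q ℕ.+ (m ∸ suc q)) * (inv q * x)
      ≈⟨ *-congʳ (fromℕ-+ (suc q) (m ∸ suc q)) ⟩
    (fromℕ (suc q) + fromℕ (m ∸ suc q)) * (inv q * x)
      ≈⟨ [a+b][cx]≈[ac]x+c[bx] _ _ _ _ ⟩
    (fromℕ (suc q) * inv q) * x + inv q * (fromℕ (m ∸ suc q) * x)
      ≈⟨ +-congʳ (trans (*-congʳ (inv-spec q)) (*-identityˡ x)) ⟩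
    x + inv q * (fromℕ (m ∸ suc q) * x) ∎
    where open ≈-Reasoning

  m*compSum-split : ∀ j m →
    fromℕ m * compSum m (suc j)
      ≈ ∑[ i < m ] compSum i j + ∑[ q < m ] (inv q * (fromℕ (m ∸ suc q) * compSum (m ∸ suc q) j))
  m*compSum-split j m = begin
    fromℕ m * compSum m (suc j)
      ≈⟨ *-congˡ (compSum-suc m j) ⟩
    fromℕ m * ∑[ q < m ] (inv q * compSum (m ∸ suc q) j)
      ≈⟨ ∑-distribˡ-* m _ _ ⟨
    ∑[ q < m ] (fromℕ m * (inv q * compSum (m ∸ suc q) j))
      ≈⟨ ∑-cong< m (λ q → m*inv[q]x≈x+inv[q][m-q-1]x m q _) ⟩
    ∑[ q < m ] (compSum (m ∸ suc q) j + inv q * (fromℕ (m ∸ suc q) * compSum (m ∸ suc q) j))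
      ≈⟨ ∑-distrib-+ m _ _ ⟩
    ∑[ q < m ] compSum (m ∸ suc q) j
      + ∑[ q < m ] (inv q * (fromℕ (m ∸ suc q) * compSum (m ∸ suc q) j))
      ≈⟨ +-congʳ (∑-reverse m (λ i → compSum i j)) ⟩
    ∑[ i < m ] compSum i j + ∑[ q < m ] (inv q * (fromℕ (m ∸ suc q) * compSum (m ∸ suc q) j)) ∎
    where open ≈-Reasoning

  m*compSum-suc : ∀ j m → fromℕ m * compSum m (suc j) ≈ fromℕ (suc j) * ∑[ i < m ] compSum i j
  weightedTail : ∀ j m →
    ∑[ q < m ] (inv q * (fromℕ (m ∸ suc q) * compSum (m ∸ suc q) j))
      ≈ fromℕ j * ∑[ i < m ] compSum i j

  m*compSum-suc j m = begin
    fromℕ m * compSum m (suc j)                           ≈⟨ m*compSum-split j m ⟩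
    ∑[ i < m ] compSum i j + ∑[ q < m ] (inv q * (fromℕ (m ∸ suc q) * compSum (m ∸ suc q) j))
      ≈⟨ +-congˡ (weightedTail j m) ⟩
    ∑[ i < m ] compSum i j + fromℕ j * ∑[ i < m ] compSum i j
      ≈⟨ +-congʳ (*-identityˡ _) ⟨
    1# * ∑[ i < m ] compSum i j + fromℕ j * ∑[ i < m ] compSum i j
      ≈⟨ distribʳ _ 1# (fromℕ j) ⟨
    fromℕ (suc j) * ∑[ i < m ] compSum i j                ∎
    where open ≈-Reasoning

  weightedTail zero m = begin
    ∑[ q < m ] (inv q * (fromℕ (m ∸ suc q) * compSum (m ∸ suc q) 0))
      ≈⟨ ∑-cong m (λ q → trans (*-congˡ (n*compSum[n,0]≈0 (m ∸ suc q))) (zeroʳ _)) ⟩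
    ∑[ q < m ] 0#                  ≈⟨ ∑-zero m ⟩
    0#                             ≈⟨ zeroˡ _ ⟨
    0# * ∑[ i < m ] compSum i 0    ∎
    where open ≈-Reasoning
  weightedTail (suc j) m = begin
    ∑[ q < m ] (inv q * (fromℕ (m ∸ suc q) * compSum (m ∸ suc q) (suc j)))
      ≈⟨ ∑-cong m (λ q → *-congˡ (m*compSum-suc j (m ∸ suc q))) ⟩
    ∑[ q < m ] (inv q * (fromℕ (suc j) * ∑[ i < m ∸ suc q ] compSum i j))
      ≈⟨ ∑-cong m (λ q → *-CS.x∙yz≈y∙xz _ _ _) ⟩
    ∑[ q < m ] (fromℕ (suc j) * (inv q * ∑[ i < m ∸ suc q ] compSum i j))
      ≈⟨ ∑-distribˡ-* m _ _ ⟩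
    fromℕ (suc j) * ∑[ q < m ] (inv q * ∑[ i < m ∸ suc q ] compSum i j)
      ≈⟨ *-congˡ (∑-convolution m inv (λ i → compSum i j)) ⟨
    fromℕ (suc j) * ∑[ n < m ] ∑[ q < n ] (inv q * compSum (n ∸ suc q) j)
      ≈⟨ *-congˡ (∑-cong m (λ n → compSum-suc n j)) ⟨
    fromℕ (suc j) * ∑[ n < m ] compSum n (suc j) ∎
    where open ≈-Reasoning

  compSum-recurrence : ∀ k j →
    fromℕ (suc k) * compSum (suc k) (suc j)
      ≈ fromℕ (suc j) * compSum k j + fromℕ k * compSum k (suc j)
  compSum-recurrence k j = begin
    fromℕ (suc k) * compSum (suc k) (suc j)
      ≈⟨ m*compSum-suc j (suc k) ⟩
    fromℕ (suc j) * (∑[ i < k ] compSum i j + compSum k j)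
      ≈⟨ distribˡ _ _ _ ⟩
    fromℕ (suc j) * ∑[ i < k ] compSum i j + fromℕ (suc j) * compSum k j
      ≈⟨ +-congʳ (m*compSum-suc j k) ⟨
    fromℕ k * compSum k (suc j) + fromℕ (suc j) * compSum k j
      ≈⟨ +-comm _ _ ⟩
    fromℕ (suc j) * compSum k j + fromℕ k * compSum k (suc j) ∎
    where open ≈-Reasoning

  signedCompSum : ℕ → ℕ → Carrier
  signedCompSum k j = sign (k ∸ j) * compSum k j

  sign-flip : ∀ k j → sign (k ∸ j) * compSum k (suc j) ≈ - signedCompSum k (suc j)
  sign-flip k j with j ℕ.<? k
  ... | yes j<k = trans (*-congʳ (reflexive (≡.cong sign (ℕₚ.+-∸-assoc 1 j<k))))
                        (sym (-‿distribˡ-* _ _))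
  ... | no  j≮k = trans (*-congˡ C≈0) (trans (zeroʳ _)
                    (sym (trans (-‿cong (trans (*-congˡ C≈0) (zeroʳ _))) -0#≈0#)))
    where
      C≈0 : compSum k (suc j) ≈ 0#
      C≈0 = compSum-vanishes (s≤s (ℕₚ.≮⇒≥ j≮k))

  signedCompSum-recurrence : ∀ k j →
    fromℕ (suc k) * signedCompSum (suc k) (suc j)
      ≈ fromℕ (suc j) * signedCompSum k j + (- fromℕ k) * signedCompSum k (suc j)
  signedCompSum-recurrence k j = begin
    fromℕ (suc k) * (sign (k ∸ j) * compSum (suc k) (suc j))
      ≈⟨ *-CS.x∙yz≈y∙xz _ _ _ ⟩
    sign (k ∸ j) * (fromℕ (suc k) * compSum (suc k) (suc j))
      ≈⟨ *-congˡ (compSum-recurrence k j) ⟩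
    sign (k ∸ j) * (fromℕ (suc j) * compSum k j + fromℕ k * compSum k (suc j))
      ≈⟨ s[ab+cd]≈a[sb]+c[sd] _ _ _ _ _ ⟩
    fromℕ (suc j) * signedCompSum k j + fromℕ k * (sign (k ∸ j) * compSum k (suc j))
      ≈⟨ +-congˡ (*-congˡ (sign-flip k j)) ⟩
    fromℕ (suc j) * signedCompSum k j + fromℕ k * (- signedCompSum k (suc j))
      ≈⟨ +-congˡ (trans (sym (-‿distribʳ-* _ _)) (-‿distribˡ-* _ _)) ⟩
    fromℕ (suc j) * signedCompSum k j + (- fromℕ k) * signedCompSum k (suc j) ∎
    where open ≈-Reasoning

  stirling₁-compSum : ∀ k j → invFact k * stirling₁ k j ≈ invFact j * signedCompSum k j
  stirling₁-compSum zero    zero    = *-congˡ (sym (trans (*-identityˡ _) compSum-zero-zero))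
  stirling₁-compSum zero    (suc j) = trans (zeroʳ _) (sym (trans (*-congˡ (zeroʳ _)) (zeroʳ _)))
  stirling₁-compSum (suc k) zero    = trans (zeroʳ _) (sym (trans (*-congˡ (zeroʳ _)) (zeroʳ _)))
  stirling₁-compSum (suc k) (suc j) = begin
    invFact (suc k) * (stirling₁ k j - K * stirling₁ k (suc j))
      ≈⟨ *-cong (invFact-suc k) (+-congˡ (-‿distribˡ-* K _)) ⟩
    (invFact k * inv k) * (stirling₁ k j + (- K) * stirling₁ k (suc j))
      ≈⟨ [xv][a+wb]≈v[xa+w[xb]] _ _ _ _ _ ⟩
    inv k * (invFact k * stirling₁ k j + (- K) * (invFact k * stirling₁ k (suc j)))
      ≈⟨ *-congˡ (+-cong (stirling₁-compSum k j) (*-congˡ (stirling₁-compSum k (suc j)))) ⟩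
    inv k * (invFact j * signedCompSum k j + (- K) * (invFact (suc j) * signedCompSum k (suc j)))
      ≈⟨ *-congˡ (+-congʳ (*-congʳ (invFact≈invFact-suc*[1+n] j))) ⟩
    inv k * ((invFact (suc j) * fromℕ (suc j)) * signedCompSum k j
              + (- K) * (invFact (suc j) * signedCompSum k (suc j)))
      ≈⟨ *-congˡ ([xy]a+w[xb]≈x[ya+wb] _ _ _ _ _) ⟩
    inv k * (invFact (suc j) * (fromℕ (suc j) * signedCompSum k j
                                 + (- K) * signedCompSum k (suc j)))
      ≈⟨ *-congˡ (*-congˡ (signedCompSum-recurrence k j)) ⟨
    inv k * (invFact (suc j) * (fromℕ (suc k) * signedCompSum (suc k) (suc j)))
      ≈⟨ v[x[ya]]≈[yv][xa] _ _ _ _ ⟩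
    (fromℕ (suc k) * inv k) * (invFact (suc j) * signedCompSum (suc k) (suc j))
      ≈⟨ trans (*-congʳ (inv-spec k)) (*-identityˡ _) ⟩
    invFact (suc j) * signedCompSum (suc k) (suc j) ∎
    where
      open ≈-Reasoning
      K = fromℕ k

  DⁿTerm-coefficient : ∀ r k j →
    invFact k * (falling r j * stirling₁ k j) ≈ binom r j * signedCompSum k j
  DⁿTerm-coefficient r k j =
    trans (*-CS.x∙yz≈y∙xz _ _ _) (trans (*-congˡ (stirling₁-compSum k j)) (sym (*-assoc _ _ _)))

  scale-invFact-DⁿTerms : ∀ r k → scale (invFact k) (DⁿTerms r k) ∼ rhsSeries r k
  scale-invFact-DⁿTerms r k = begin
    scale (invFact k) (DⁿTerms r k)
      ≡⟨ Listₚ.map-applyUpTo (DⁿTerm r k) _ (suc k) ⟩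
    applyUpTo (λ j → (invFact k * (falling r j * stirling₁ k j) , M j)) (suc k)
      ≈⟨ applyUpTo-cong (suc k) {λ j → (invFact k * (falling r j * stirling₁ k j) , M j)}
                                {λ j → (binom r j * signedCompSum k j , M j)}
                        (DⁿTerm-coefficient r k) (λ j → ≋-refl {M j}) ⟩
    applyUpTo (λ j → (binom r j * signedCompSum k j , M j)) (suc k)
      ≡⟨ Listₚ.map-upTo _ (suc k) ⟨
    rhsSeries r k ∎
    where
      open ∼-Reasoning
      M : ℕ → Mono
      M j = ℓ₁^ (r - fromℕ j) ℓ₀^ (- fromℕ k)

mainTheorem10 : {c ℓ : Level} (A : QAlgebra c ℓ) (r : QAlgebra.Carrier A) →
    let open Construction A in expYD (ℓ₁^ r) ≈PS rhsSeries r
mainTheorem10 A r k = begin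
  scale (invFact k) (Dⁿ k (ℓ₁^ r))   ≈⟨ scale-cong A (invFact k) (Dⁿ-ℓ₁^ A r k) ⟩
  scale (invFact k) (DⁿTerms A r k)  ≈⟨ scale-invFact-DⁿTerms A r k ⟩
  rhsSeries r k                      ∎
  where
    open Construction A
    open ∼-Reasoning A
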